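{- Let $H$ be a hypergraph with no isolated vertices and let $p\in(0,1)$. Let $V$ be a smallest set of vertices of $H$ such that, for every edge $e$ of $H$, at least $\lceil p|e|\rceil$ vertices of $e$ lie in $V$. Then $b_{L,p}(H)\leq |V|$ and $b_p(H)\leq |V|+1$.
   Context: A hypergraph $H=(V(H),E(H))$ has a finite nonempty vertex set and a finite collection $E(H)$ of subsets of $V(H)$ called edges (parallel edges allowed); a vertex is isolated if it lies in no edge. For a proportion $p\in(0,1)$, the proportion-based propagation rule is: if at the end of a round at least $\lceil p|e|\rceil$ vertices of an edge $e$ are on fire, then in the next round all vertices of $e$ catch fire; burned vertices stay burned. Burning game: let $F_0=\emptyset$ and $F_r$ be the set of burned vertices at the end of round $r$. In each round $r\geq 1$, simultaneously, vertices catch fire by propagation from $F_{r-1}$ (no propagation in round 1), and a player chooses a vertex $u_r\notin F_{r-1}$ (a source) and sets it on fire. A burning sequence is a sequence $(u_1,\ldots,u_k)$ of such sources after which every vertex is on fire at the end of round $k$; $b_p(H)$ is the minimum length of a burning sequence. Lazy game: $S\subseteq V(H)$ is a lazy burning set if, setting all of $S$ on fire at once and then repeatedly applying the propagation rule, every vertex eventually catches fire; $b_{L,p}(H)$ is the minimum size of a lazy burning set. -}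

module Defs where

open import Data.Nat using (ℕ; zero; suc; _≤_; _+_)
open import Data.Integer as ℤ using (ℤ; +_)
open import Data.Rational as ℚ using (ℚ; _/_; _*_; _<_; 0ℚ; 1ℚ; ceiling)
open import Data.Fin using (Fin)
open import Data.Fin.Subset as Sub using (Subset; ⁅_⁆; _∈_; _∉_; _∩_; _∪_; ∣_∣)
open import Data.List using (List; []; _∷_; foldr)
open import Data.List.Membership.Propositional as L using ()
open import Data.Product using (_×_; ∃; ∃-syntax; Σ-syntax)
open import Data.Unit using (⊤)
open import Relation.Binary.PropositionalEquality using (_≡_)
open import Relation.Nullary.Decidable using (does)
open import Data.Bool using (if_then_else_)

-- A hypergraph on the vertex set Fin n: a finite list of edges
-- (a list, so parallel edges are allowed), each a subset of Fin n.
record Hypergraph : Set where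
  field
    n     : ℕ
    edges : List (Subset n)
open Hypergraph public

NonemptyVertexSet : Hypergraph → Set
NonemptyVertexSet H = 1 ≤ n H

NoIsolatedVertices : Hypergraph → Set
NoIsolatedVertices H = (v : Fin (n H)) → ∃[ e ] (e L.∈ edges H × v ∈ e)

threshold : ℚ → ℕ → ℤ
threshold p k = ⌈ p * (+ k / 1) ⌉

ignites : (p : ℚ) {m : ℕ} → Subset m → Subset m → Set
ignites p e F = threshold p ∣ e ∣ ℤ.≤ + ∣ e ∩ F ∣

propagate : (p : ℚ) (H : Hypergraph) → Subset (n H) → Subset (n H)
propagate p H F =
  F ∪ foldr (λ e acc → if does (threshold p ∣ e ∣ ℤ.≤? + ∣ e ∩ F ∣) then e ∪ acc else acc)
            Sub.⊥ (edges H)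

iterate : {A : Set} → (A → A) → ℕ → A → A
iterate f zero x = x
iterate f (suc t) x = f (iterate f t x)

IsLazyBurningSet : (p : ℚ) (H : Hypergraph) → Subset (n H) → Set
IsLazyBurningSet p H S = ∃[ t ] (iterate (propagate p H) t S ≡ Sub.⊤)

-- Burning game. Given the fire F_{r-1} at the end of some round r-1 ≥ 1,
-- play the remaining sources u_r, u_{r+1}, ...:
-- F_r = propagate(F_{r-1}) ∪ {u_r}, and u_r ∉ F_{r-1} is required.
validFrom : (p : ℚ) (H : Hypergraph) → Subset (n H) → List (Fin (n H)) → Set
validFrom p H F [] = ⊤
validFrom p H F (u ∷ us) = u ∉ F × validFrom p H (propagate p H F ∪ ⁅ u ⁆) us

runFrom : (p : ℚ) (H : Hypergraph) → Subset (n H) → List (Fin (n H)) → Subset (n H)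
runFrom p H F [] = F
runFrom p H F (u ∷ us) = runFrom p H (propagate p H F ∪ ⁅ u ⁆) us

-- (u_1, ..., u_k) is a burning sequence: F_0 = ∅, F_1 = {u_1} (no propagation
-- in round 1; u_1 ∉ F_0 trivially), later rounds as above, and F_k = V(H).
IsBurningSequence : (p : ℚ) (H : Hypergraph) → List (Fin (n H)) → Set
IsBurningSequence p H [] = Sub.⊥ {n H} ≡ Sub.⊤
IsBurningSequence p H (u ∷ us) =
  validFrom p H ⁅ u ⁆ us × runFrom p H ⁅ u ⁆ us ≡ Sub.⊤

CoversProportionally : (p : ℚ) (H : Hypergraph) → Subset (n H) → Set
CoversProportionally p H V = ∀ e → e L.∈ edges H → ignites p e V

-- A fire containing V ignites every edge at once, and as no vertex is isolated the next
-- propagation round burns everything; so V is a lazy burning set. In the burning game,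
-- choose as sources the vertices of V that are not yet burning, one per round, starting
-- anywhere in V. Every source shrinks the unburnt part of V, so after at most |V| rounds
-- V is on fire; the following round propagates to all of H (with one last source, if any
-- vertex is still unburnt). V is nonempty because p > 0 makes every threshold positive.
module Submission where

open import Defs
open import Data.Nat using (ℕ; suc; _≤_)
open import Data.Rational using (ℚ; _<_; 0ℚ; 1ℚ)
open import Data.Fin.Subset using (Subset; ∣_∣)
open import Data.List using (List; length)
open import Data.Product using (_×_; ∃-syntax)

open import Data.Bool using (if_then_else_)
open import Data.Fin using (Fin; fromℕ<)
open import Data.Fin.Subset as Sub
  using (_∈_; _∉_; _⊆_; _∪_; _∩_; _─_; ∁; ⁅_⁆; Nonempty; Empty; inside; outside)
open import Data.Fin.Subset.Properties
open import Data.Integer as ℤ using (+_; 0ℤ)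
open import Data.Integer.DivMod using ([n/d]*d≤n)
import Data.Integer.Properties as ℤP
open import Data.List using ([]; _∷_; foldr)
open import Data.List.Membership.Propositional as List using ()
open import Data.List.Relation.Unary.Any using (here; there)
import Data.Nat as ℕ
open import Data.Nat.Induction using (<-wellFounded)
import Data.Nat.Properties as ℕP
open import Data.Product using (_,_; proj₂)
import Data.Rational as ℚ
import Data.Rational.Properties as ℚP
open import Data.Sum using (inj₁; inj₂)
open import Data.Unit using (tt)
open import Data.Vec using (_∷_; here; there)
open import Function using (_∘_)
open import Induction.WellFounded using (Acc; acc)
open import Relation.Binary.PropositionalEquality using (_≡_; refl; cong; subst; sym; trans)
open import Relation.Nullary using (yes; no; contradiction)
open import Relation.Nullary.Decidable using (does)

floor<0 : ∀ q → q < 0ℚ → ℚ.floor q ℤ.< 0ℤ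
floor<0 q@record{} (ℚ.*<* q<0) = ℤP.*-cancelʳ-<-nonNeg (ℚ.↧ q) (begin-strict
  ℚ.floor q ℤ.* ℚ.↧ q  ≤⟨ [n/d]*d≤n (ℚ.↥ q) (ℚ.↧ q) ⟩
  ℚ.↥ q                ≡⟨ ℤP.*-identityʳ (ℚ.↥ q) ⟨
  ℚ.↥ q ℤ.* + 1        <⟨ q<0 ⟩
  0ℤ ℤ.* ℚ.↧ q         ∎)
  where open ℤP.≤-Reasoning

ceiling>0 : ∀ q → 0ℚ < q → 0ℤ ℤ.< ℚ.ceiling q
ceiling>0 q@record{} 0<q = ℤP.neg-mono-< (floor<0 (ℚ.- q) (ℚP.neg-antimono-< 0<q))

threshold>0 : ∀ {p k} → 0ℚ < p → 0 ℕ.< k → 0ℤ ℤ.< threshold p k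
threshold>0 {p} {suc m} 0<p _ = ceiling>0 (p ℚ.* k) (ℚP.positive⁻¹ (p ℚ.* k)
  {{ℚP.pos*pos⇒pos p {{ℚ.positive 0<p}} k {{ℚP.normalize-pos (suc m) 1}}}})
  where k = + suc m ℚ./ 1

ignites-nonempty : ∀ {p m} {e F : Subset m} → 0ℚ < p → Nonempty e →
                   ignites p e F → Nonempty (e ∩ F)
ignites-nonempty {m = m} {e} {F} 0<p (x , x∈e) e-ignites with nonempty? (e ∩ F)
... | yes e∩F-nonempty = e∩F-nonempty
... | no e∩F-empty = contradiction
  (subst (λ c → 0ℤ ℤ.< + c) ∣e∩F∣≡0
    (ℤP.<-≤-trans (threshold>0 {k = ∣ e ∣} 0<p (ℕP.≤-<-trans ℕ.z≤n (x∈p⇒∣p-x∣<∣p∣ x∈e))) e-ignites))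
  ℤP.+≮0
  where
    ∣e∩F∣≡0 : ∣ e ∩ F ∣ ≡ 0
    ∣e∩F∣≡0 = trans (cong ∣_∣ (Empty-unique e∩F-empty)) (∣⊥∣≡0 m)

∀∈⇒≡⊤ : ∀ {m} {F : Subset m} → (∀ x → x ∈ F) → F ≡ Sub.⊤
∀∈⇒≡⊤ all∈ = ⊆-antisym ⊆⊤ (λ {x} _ → all∈ x)

x∈p─q⇒x∉q : ∀ {m} {p q : Subset m} {x} → x ∈ p ─ q → x ∉ q
x∈p─q⇒x∉q {p = _ ∷ p} {inside  ∷ q} (there x∈p─q) (there x∈q) = x∈p─q⇒x∉q x∈p─q x∈q
x∈p─q⇒x∉q {p = _ ∷ p} {outside ∷ q} (there x∈p─q) (there x∈q) = x∈p─q⇒x∉q x∈p─q x∈q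

p─q⊆p─r : ∀ {m} {p q r : Subset m} → r ⊆ q → p ─ q ⊆ p ─ r
p─q⊆p─r {p = p} {q} r⊆q x∈p─q = x∈p∧x∉q⇒x∈p─q (p─q⊆p p q x∈p─q) (x∈p─q⇒x∉q x∈p─q ∘ r⊆q)

∪-monoˡ-⊆ : ∀ {m} {p q r : Subset m} → p ⊆ q → p ∪ r ⊆ q ∪ r
∪-monoˡ-⊆ {p = p} {r = r} p⊆q x∈p∪r with x∈p∪q⁻ p r x∈p∪r
... | inj₁ x∈p = x∈p∪q⁺ (inj₁ (p⊆q x∈p))
... | inj₂ x∈r = x∈p∪q⁺ (inj₂ x∈r)

Empty─⇒⊆ : ∀ {m} {p q : Subset m} → Empty (p ─ q) → p ⊆ q
Empty─⇒⊆ {q = q} p─q-empty {x} x∈p with x ∈? q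
... | yes x∈q = x∈q
... | no x∉q = contradiction (x , x∈p∧x∉q⇒x∈p─q x∈p x∉q) p─q-empty

ignites-mono : ∀ {p m} {e F G : Subset m} → F ⊆ G → ignites p e F → ignites p e G
ignites-mono {e = e} F⊆G e-ignites =
  ℤP.≤-trans e-ignites (ℤ.+≤+ (p⊆q⇒∣p∣≤∣q∣ (λ x∈e∩F →
    let x∈e , x∈F = x∈p∩q⁻ e _ x∈e∩F in x∈p∩q⁺ (x∈e , F⊆G x∈F))))

module Propagation (p : ℚ) (H : Hypergraph) where

  ignitedBy : Subset (n H) → List (Subset (n H)) → Subset (n H)
  ignitedBy F = foldr (λ e acc → if does (threshold p ∣ e ∣ ℤ.≤? + ∣ e ∩ F ∣) then e ∪ acc else acc)
                      Sub.⊥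

  ∈-ignitedBy : ∀ {F e x} es → e List.∈ es → ignites p e F → x ∈ e → x ∈ ignitedBy F es
  ∈-ignitedBy {F} (e ∷ es) (here refl) e-ignites x∈e with threshold p ∣ e ∣ ℤ.≤? + ∣ e ∩ F ∣
  ... | yes _ = x∈p∪q⁺ (inj₁ x∈e)
  ... | no e-dormant = contradiction e-ignites e-dormant
  ∈-ignitedBy {F} (e′ ∷ es) (there e∈es) e-ignites x∈e with threshold p ∣ e′ ∣ ℤ.≤? + ∣ e′ ∩ F ∣
  ... | yes _ = x∈p∪q⁺ (inj₂ (∈-ignitedBy es e∈es e-ignites x∈e))
  ... | no _ = ∈-ignitedBy es e∈es e-ignites x∈e

  ⊆-propagate : ∀ {F} → F ⊆ propagate p H F
  ⊆-propagate = x∈p∪q⁺ ∘ inj₁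

  ∈-propagate : ∀ {F e x} → e List.∈ edges H → ignites p e F → x ∈ e → x ∈ propagate p H F
  ∈-propagate e∈E e-ignites x∈e = x∈p∪q⁺ (inj₂ (∈-ignitedBy (edges H) e∈E e-ignites x∈e))

  module Cover (no-isolated : NoIsolatedVertices H) {V : Subset (n H)}
               (V-covers : CoversProportionally p H V) where

    ∈-propagate-⊇cover : ∀ {F} → V ⊆ F → ∀ x → x ∈ propagate p H F
    ∈-propagate-⊇cover V⊆F x =
      let e , e∈E , x∈e = no-isolated x
      in ∈-propagate e∈E (ignites-mono {p} {e = e} V⊆F (V-covers e e∈E)) x∈e

    lazyBurningSet : IsLazyBurningSet p H V
    lazyBurningSet = 1 , ∀∈⇒≡⊤ (∈-propagate-⊇cover ⊆-refl)

    BurnsFrom : Subset (n H) → List (Fin (n H)) → Set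
    BurnsFrom F us = validFrom p H F us × runFrom p H F us ≡ Sub.⊤

    finishFrom : ∀ {F} → V ⊆ F → ∃[ us ] (BurnsFrom F us × length us ≤ 1)
    finishFrom {F} V⊆F with nonempty? (∁ F)
    ... | yes (w , w∈∁F) = w ∷ [] , ((x∈∁p⇒x∉p w∈∁F , tt) , burnt) , ℕP.≤-refl
      where burnt = ∀∈⇒≡⊤ (p⊆p∪q ⁅ w ⁆ ∘ ∈-propagate-⊇cover V⊆F)
    ... | no ∁F-empty = [] , ((tt , ∀∈⇒≡⊤ λ x → x∉∁p⇒x∈p λ x∈∁F → ∁F-empty (x , x∈∁F))) , ℕ.z≤n

    completeFrom : ∀ F → Acc ℕ._<_ ∣ V ─ F ∣ →
                   ∃[ us ] (BurnsFrom F us × length us ≤ suc ∣ V ─ F ∣)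
    completeFrom F (acc rec) with nonempty? (V ─ F)
    ... | no V─F-empty =
      let us , burns , len = finishFrom (Empty─⇒⊆ V─F-empty)
      in us , burns , ℕP.≤-trans len (ℕ.s≤s ℕ.z≤n)
    ... | yes (v , v∈V─F) =
      let us , (valid , burnt) , len = completeFrom F′ (rec shrinks)
      in v ∷ us , ((x∈p─q⇒x∉q v∈V─F , valid) , burnt) , ℕ.s≤s (ℕP.≤-trans len shrinks)
      where
        F′ = propagate p H F ∪ ⁅ v ⁆
        shrinks : ∣ V ─ F′ ∣ ℕ.< ∣ V ─ F ∣
        shrinks = ℕP.≤-<-trans
          (p⊆q⇒∣p∣≤∣q∣ (subst (V ─ F′ ⊆_) (sym (p─q─r≡p─q∪r V F ⁅ v ⁆))
            (p─q⊆p─r (∪-monoˡ-⊆ ⊆-propagate))))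
          (x∈p⇒∣p-x∣<∣p∣ v∈V─F)

    cover-nonempty : NonemptyVertexSet H → 0ℚ < p → Nonempty V
    cover-nonempty 1≤n 0<p =
      let e , e∈E , v∈e = no-isolated (fromℕ< 1≤n)
          x , x∈e∩V = ignites-nonempty 0<p (_ , v∈e) (V-covers e e∈E)
      in x , proj₂ (x∈p∩q⁻ e V x∈e∩V)

    burningSequence : NonemptyVertexSet H → 0ℚ < p →
                      ∃[ us ] (IsBurningSequence p H us × length us ≤ suc ∣ V ∣)
    burningSequence 1≤n 0<p =
      let u , u∈V = cover-nonempty 1≤n 0<p
          us , burns , len = completeFrom ⁅ u ⁆ (<-wellFounded _)
      in u ∷ us , burns , ℕ.s≤s (ℕP.≤-trans len (x∈p⇒∣p-x∣<∣p∣ u∈V))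

theorem2p16 : (H : Hypergraph) → NonemptyVertexSet H → NoIsolatedVertices H →
              (p : ℚ) → 0ℚ < p → p < 1ℚ →
              (V : Subset (n H)) → CoversProportionally p H V →
              ((W : Subset (n H)) → CoversProportionally p H W → ∣ V ∣ ≤ ∣ W ∣) →
              (∃[ S ] (IsLazyBurningSet p H S × ∣ S ∣ ≤ ∣ V ∣))
              × (∃[ us ] (IsBurningSequence p H us × length us ≤ suc ∣ V ∣))
theorem2p16 H 1≤n no-isolated p 0<p _ V V-covers _ =
  (V , lazyBurningSet , ℕP.≤-refl) , burningSequence 1≤n 0<p
  where open Propagation.Cover p H no-isolated V-covers
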